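{- (i) If $Q\in\Lambda_{\circledR}^{[/]}$ and $Q\twoheadrightarrow^{[/]}R$, then $R\in\Lambda_{\circledR}^{[/]}$. (ii) If $Q\in\Lambda_{\circledR}^{[/]}$ and $Q\twoheadrightarrow^{[/]}R$, then $Fv^{[/]}(Q)=Fv^{[/]}(R)$.
   Context: Fix a countably infinite set of variables. The set $\Lambda_{\circledR}$ of terms and $Fv(M)$ are defined simultaneously: every variable $x$ is a term with $Fv(x)=\{x\}$; $\lambda x.M$ is a term if $M$ is a term and $x\in Fv(M)$ ($Fv=Fv(M)\setminus\{x\}$); $MN$ is a term if $M,N$ are terms with $Fv(M)\cap Fv(N)=\emptyset$ ($Fv=Fv(M)\cup Fv(N)$); $x\odot M$ (erasure) is a term if $M$ is a term and $x\notin Fv(M)$ ($Fv=\{x\}\cup Fv(M)$); $x<^{x_1}_{x_2}M$ (duplication) is a term if $M$ is a term, $x_1,x_2\in Fv(M)$, $x_1\neq x_2$, $x\notin Fv(M)\setminus\{x_1,x_2\}$ ($Fv=\{x\}\cup(Fv(M)\setminus\{x_1,x_2\})$). $\lambda x$ binds $x$, duplication binds $x_1,x_2$; $\alpha$-conversion and Barendregt's convention are assumed. $Fv[M]$ is the ordered list of free variables. For lists $X,Y,Z$ of equal length, $X\odot M$ and $X<^{Y}_{Z}M$ denote iterated erasures/duplications ($=M$ for empty lists). The set $\Lambda_{\circledR}^{[/]}$ and $Fv^{[/]}$ are defined by the same clauses (with $Fv^{[/]}$ in place of $Fv$) plus: $M[N/x]\in\Lambda_{\circledR}^{[/]}$ if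 $M\in\Lambda_{\circledR}^{[/]}$, $x\in Fv^{[/]}(M)$, $N\in\Lambda_{\circledR}$ and $(Fv^{[/]}(M)\setminus\{x\})\cap Fv(N)=\emptyset$, with $Fv^{[/]}(M[N/x])=(Fv^{[/]}(M)\setminus\{x\})\cup Fv(N)$ ($x$ is bound in $M$). The one-step relation $\to^{[/]}$ is closed under $\alpha$-equivalence and contexts and given by: $x[N/x]\to N$; $(\lambda y.M)[N/x]\to\lambda y.M[N/x]$ ($x\ne y$); $(MP)[N/x]\to M[N/x]P$ if $x\in Fv^{[/]}(M)$; $(MP)[N/x]\to M\,P[N/x]$ if $x\in Fv^{[/]}(P)$; $(y\odot M)[N/x]\to y\odot M[N/x]$ ($x\neq y$); $(x\odot M)[N/x]\to Fv(N)\odot M$; $(y<^{y_1}_{y_2}M)[N/x]\to y<^{y_1}_{y_2}M[N/x]$ ($x\ne y$); $(x<^{x_1}_{x_2}M)[N/x]\to Fv[N]<^{Fv[N_1]}_{Fv[N_2]}M[N_1/x_1][N_2/x_2]$, with $N_1,N_2$ obtained from $N$ by renaming all free variables to fresh ones. $\twoheadrightarrow^{[/]}$ is its reflexive-transitive closure. -}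

module Defs where

open import Data.Nat using (ℕ; _≟_)
open import Data.Bool using (Bool; true; false; if_then_else_)
open import Data.List using (List; []; _∷_; _++_; filter; length; zip)
open import Data.List.Membership.Propositional using (_∈_; _∉_)
open import Data.List.Relation.Unary.Unique.Propositional using (Unique)
open import Data.Product using (_×_; _,_)
open import Data.Empty using (⊥)
open import Relation.Nullary using (¬_; ¬?; does)
open import Relation.Binary.PropositionalEquality using (_≡_; _≢_)
open import Relation.Binary.Construct.Closure.ReflexiveTransitive using (Star)

Var : Set
Var = ℕ

data Term : Set where
  var : Var → Term
  lam : Var → Term → Term
  app : Term → Term → Term
  era : Var → Term → Term
  dup : Var → Var → Var → Term → Term     -- dup x x₁ x₂ M  =  x <^{x₁}_{x₂} M
  sub : Term → Term → Var → Term          -- sub M N x  =  M[N/x]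

remove : Var → List Var → List Var
remove x = filter (λ y → ¬? (y ≟ x))

Disjoint : List Var → List Var → Set
Disjoint xs ys = ∀ {v} → v ∈ xs → v ∈ ys → ⊥

-- Free variables (ordered list Fv[M]); on well-formed terms this is
-- Fv / Fv^{[/]} of the paper (each free variable occurs exactly once).

fv : Term → List Var
fv (var x)         = x ∷ []
fv (lam x M)       = remove x (fv M)
fv (app M N)       = fv M ++ fv N
fv (era x M)       = x ∷ fv M
fv (dup x x₁ x₂ M) = x ∷ remove x₂ (remove x₁ (fv M))
fv (sub M N x)     = remove x (fv M) ++ fv N

allVars : Term → List Var
allVars (var x)         = x ∷ []
allVars (lam x M)       = x ∷ allVars M
allVars (app M N)       = allVars M ++ allVars N
allVars (era x M)       = x ∷ allVars M
allVars (dup x x₁ x₂ M) = x ∷ x₁ ∷ x₂ ∷ allVars M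
allVars (sub M N x)     = x ∷ allVars M ++ allVars N

-- Well-formed terms: Λ_® (WF₀) and Λ_®^{[/]} (WF)

data WF₀ : Term → Set where
  var : ∀ x → WF₀ (var x)
  lam : ∀ {x M} → WF₀ M → x ∈ fv M → WF₀ (lam x M)
  app : ∀ {M N} → WF₀ M → WF₀ N → Disjoint (fv M) (fv N) → WF₀ (app M N)
  era : ∀ {x M} → WF₀ M → x ∉ fv M → WF₀ (era x M)
  dup : ∀ {x x₁ x₂ M} → WF₀ M → x₁ ∈ fv M → x₂ ∈ fv M → x₁ ≢ x₂ →
        x ∉ remove x₂ (remove x₁ (fv M)) → WF₀ (dup x x₁ x₂ M)

data WF : Term → Set where
  var : ∀ x → WF (var x)
  lam : ∀ {x M} → WF M → x ∈ fv M → WF (lam x M)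
  app : ∀ {M N} → WF M → WF N → Disjoint (fv M) (fv N) → WF (app M N)
  era : ∀ {x M} → WF M → x ∉ fv M → WF (era x M)
  dup : ∀ {x x₁ x₂ M} → WF M → x₁ ∈ fv M → x₂ ∈ fv M → x₁ ≢ x₂ →
        x ∉ remove x₂ (remove x₁ (fv M)) → WF (dup x x₁ x₂ M)
  sub : ∀ {M N x} → WF M → x ∈ fv M → WF₀ N →
        Disjoint (remove x (fv M)) (fv N) → WF (sub M N x)

swapVar : Var → Var → Var → Var
swapVar a b z = if does (z ≟ a) then b else (if does (z ≟ b) then a else z)

swap : Var → Var → Term → Term
swap a b (var x)         = var (swapVar a b x)
swap a b (lam x M)       = lam (swapVar a b x) (swap a b M)
swap a b (app M N)       = app (swap a b M) (swap a b N)
swap a b (era x M)       = era (swapVar a b x) (swap a b M)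
swap a b (dup x x₁ x₂ M) = dup (swapVar a b x) (swapVar a b x₁) (swapVar a b x₂) (swap a b M)
swap a b (sub M N x)     = sub (swap a b M) (swap a b N) (swapVar a b x)

Ren : Set
Ren = List (Var × Var)

lookupRen : Ren → Var → Var
lookupRen []             z = z
lookupRen ((a , b) ∷ ρ)  z = if does (z ≟ a) then b else lookupRen ρ z

dropRen : Var → Ren → Ren
dropRen x = filter (λ p → ¬? (Data.Product.proj₁ p ≟ x))
  where import Data.Product

rename : Ren → Term → Term
rename ρ (var x)         = var (lookupRen ρ x)
rename ρ (lam x M)       = lam x (rename (dropRen x ρ) M)
rename ρ (app M N)       = app (rename ρ M) (rename ρ N)
rename ρ (era x M)       = era (lookupRen ρ x) (rename ρ M)
rename ρ (dup x x₁ x₂ M) = dup (lookupRen ρ x) x₁ x₂ (rename (dropRen x₂ (dropRen x₁ ρ)) M)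
rename ρ (sub M N x)     = sub (rename (dropRen x ρ) M) (rename ρ N) x

erasures : List Var → Term → Term
erasures []      M = M
erasures (x ∷ X) M = era x (erasures X M)

dups : List Var → List Var → List Var → Term → Term
dups (x ∷ X) (y ∷ Y) (z ∷ Z) M = dup x y z (dups X Y Z M)
dups _       _       _       M = M

infix 4 _≈α_
data _≈α_ : Term → Term → Set where
  α-refl  : ∀ {M} → M ≈α M
  α-sym   : ∀ {M N} → M ≈α N → N ≈α M
  α-trans : ∀ {M N P} → M ≈α N → N ≈α P → M ≈α P
  α-lam   : ∀ {x M M'} → M ≈α M' → lam x M ≈α lam x M'
  α-appˡ  : ∀ {M M' N} → M ≈α M' → app M N ≈α app M' N
  α-appʳ  : ∀ {M N N'} → N ≈α N' → app M N ≈α app M N'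
  α-era   : ∀ {x M M'} → M ≈α M' → era x M ≈α era x M'
  α-dup   : ∀ {x x₁ x₂ M M'} → M ≈α M' → dup x x₁ x₂ M ≈α dup x x₁ x₂ M'
  α-subˡ  : ∀ {M M' N x} → M ≈α M' → sub M N x ≈α sub M' N x
  α-subʳ  : ∀ {M N N' x} → N ≈α N' → sub M N x ≈α sub M N' x
  α-λ     : ∀ {x y M} → y ∉ fv M → lam x M ≈α lam y (swap x y M)
  α-dup₁  : ∀ {x x₁ x₂ y M} → y ∉ fv M → y ≢ x₂ →
            dup x x₁ x₂ M ≈α dup x y x₂ (swap x₁ y M)
  α-dup₂  : ∀ {x x₁ x₂ y M} → y ∉ fv M → y ≢ x₁ →
            dup x x₁ x₂ M ≈α dup x x₁ y (swap x₂ y M)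
  α-sub   : ∀ {x y M N} → y ∉ fv M → sub M N x ≈α sub (swap x y M) N y

-- Base reduction rules of →^{[/]} (bound-variable side conditions are
-- those implied by Barendregt's convention)

data _↦_ : Term → Term → Set where
  r-var   : ∀ {x N} → sub (var x) N x ↦ N
  r-lam   : ∀ {x y M N} → x ≢ y → y ∉ fv N →
            sub (lam y M) N x ↦ lam y (sub M N x)
  r-appˡ  : ∀ {x M P N} → x ∈ fv M →
            sub (app M P) N x ↦ app (sub M N x) P
  r-appʳ  : ∀ {x M P N} → x ∈ fv P →
            sub (app M P) N x ↦ app M (sub P N x)
  r-era   : ∀ {x y M N} → x ≢ y →
            sub (era y M) N x ↦ era y (sub M N x)
  r-eraₓ  : ∀ {x M N} →
            sub (era x M) N x ↦ erasures (fv N) M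
  r-dup   : ∀ {x y y₁ y₂ M N} → x ≢ y → y₁ ∉ fv N → y₂ ∉ fv N →
            sub (dup y y₁ y₂ M) N x ↦ dup y y₁ y₂ (sub M N x)
  -- N₁, N₂: N with its free variables Fv[N] renamed to the fresh lists Y, Z
  r-dupₓ  : ∀ {x x₁ x₂ M N} (Y Z : List Var) →
            length Y ≡ length (fv N) → length Z ≡ length (fv N) →
            Unique (Y ++ Z) →
            Disjoint (Y ++ Z) (allVars (sub (dup x x₁ x₂ M) N x)) →
            sub (dup x x₁ x₂ M) N x ↦
              dups (fv N) (fv (rename (zip (fv N) Y) N)) (fv (rename (zip (fv N) Z) N))
                   (sub (sub M (rename (zip (fv N) Y) N) x₁) (rename (zip (fv N) Z) N) x₂)

data _⟶c_ : Term → Term → Set where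
  c-base : ∀ {M M'} → M ↦ M' → M ⟶c M'
  c-lam  : ∀ {x M M'} → M ⟶c M' → lam x M ⟶c lam x M'
  c-appˡ : ∀ {M M' N} → M ⟶c M' → app M N ⟶c app M' N
  c-appʳ : ∀ {M N N'} → N ⟶c N' → app M N ⟶c app M N'
  c-era  : ∀ {x M M'} → M ⟶c M' → era x M ⟶c era x M'
  c-dup  : ∀ {x x₁ x₂ M M'} → M ⟶c M' → dup x x₁ x₂ M ⟶c dup x x₁ x₂ M'
  c-subˡ : ∀ {M M' N x} → M ⟶c M' → sub M N x ⟶c sub M' N x
  c-subʳ : ∀ {M N N' x} → N ⟶c N' → sub M N x ⟶c sub M N' x

data _⟶_ : Term → Term → Set where
  step : ∀ {M M' N' N} → M ≈α M' → M' ⟶c N' → N' ≈α N → M ⟶ N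

_↠_ : Term → Term → Set
_↠_ = Star _⟶_

module Submission where

-- Write M ⊑ N for "if M is well formed, then so is N, and M, N
-- have the same free variables".  The relation ⊑ is reflexive, transitive and
-- a congruence for all term constructors, so it suffices to check it for the
-- ingredients of one step M →^{[/]} N:
--   * α-conversion, i.e. renaming a bound variable by a swap, which acts
--     injectively and so commutes with free variables (in both directions);
--   * each of the eight base rules, by a small computation of `fv` with
--     `remove`, `++` and disjointness.  For the duplication rule we show that
--     the renamed copies N₁, N₂ of N are terms of Λ_® with the fresh lists as
--     free variables, and compute the free variables of iterated duplications;
--   * steps below an explicit substitution [N/x] can only happen in the
--     left part, since N ∈ Λ_® contains no redex.

open import Defs
open import Data.Nat using (_≟_)
open import Data.Nat.Properties using (suc-injective)
open import Data.Bool using (if_then_else_)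
open import Data.Product using (_×_; _,_; proj₁; proj₂)
import Data.Product as Product
open import Data.Sum using (_⊎_; inj₁; inj₂)
import Data.Sum as Sum
open import Data.Empty using (⊥; ⊥-elim)
open import Data.Unit using (⊤; tt)
open import Data.List using (List; []; _∷_; _++_; map; length; zip)
open import Data.List.Properties
  using (filter-accept; filter-reject; filter-++; ++-assoc; map-++; map-id-local; map-cong-local;
         ∷-injectiveʳ)
open import Data.List.Relation.Unary.Any using (here; there)
open import Data.List.Relation.Unary.All using ([]; _∷_)
import Data.List.Relation.Unary.All as All
open import Data.List.Relation.Unary.All.Properties using (¬Any⇒All¬; All¬⇒¬Any)
open import Data.List.Membership.Propositional using (_∈_; _∉_)
open import Data.List.Membership.Propositional.Properties
  using (∈-++⁺ˡ; ∈-++⁺ʳ; ∈-++⁻; ∈-filter⁺; ∈-filter⁻; ∈-map⁺; ∈-map⁻)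
open import Data.List.Relation.Binary.Subset.Propositional using (_⊆_)
open import Data.List.Relation.Binary.Subset.Propositional.Properties
  using (⊆-refl; ⊆-trans; ∷⁺ʳ; ++⁺; xs⊆xs++ys; xs⊆ys++xs; xs⊆x∷xs)
open import Data.List.Relation.Unary.Unique.Propositional using (Unique; []; _∷_)
import Data.List.Relation.Unary.Unique.Propositional.Properties as Unique
open import Relation.Nullary using (¬_; ¬?; yes; no; does)
open import Relation.Nullary.Decidable using (dec-true; dec-false)
open import Relation.Binary.PropositionalEquality
open import Function using (_∘_; id)
open import Function.Definitions using (Injective)
open import Function.Bundles using (_⇔_; mk⇔)
open import Relation.Binary.Construct.Closure.ReflexiveTransitive using (ε; _◅_)

∈-remove⁻ : ∀ {x z} l → z ∈ remove x l → z ∈ l × z ≢ x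
∈-remove⁻ {x} l = ∈-filter⁻ (λ y → ¬? (y ≟ x)) {xs = l}

∈-remove⁺ : ∀ {x z l} → z ∈ l → z ≢ x → z ∈ remove x l
∈-remove⁺ {x} = ∈-filter⁺ (λ y → ¬? (y ≟ x))

remove-⊆ : ∀ {x A B} → A ⊆ B → remove x A ⊆ remove x B
remove-⊆ {A = A} A⊆B z∈ = let z∈A , z≢x = ∈-remove⁻ A z∈ in ∈-remove⁺ (A⊆B z∈A) z≢x

remove-self : ∀ x l → remove x (x ∷ l) ≡ remove x l
remove-self x l = filter-reject (λ y → ¬? (y ≟ x)) (λ x≢x → x≢x refl)

remove-other : ∀ {x y} l → y ≢ x → remove x (y ∷ l) ≡ y ∷ remove x l
remove-other {x} l = filter-accept (λ y → ¬? (y ≟ x))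

remove-fresh : ∀ {x} l → x ∉ l → remove x l ≡ l
remove-fresh [] x∉ = refl
remove-fresh (y ∷ l) x∉ =
  trans (remove-other l (λ y≡x → x∉ (here (sym y≡x))))
        (cong (y ∷_) (remove-fresh l (λ x∈ → x∉ (there x∈))))

remove-++ : ∀ x A B → remove x (A ++ B) ≡ remove x A ++ remove x B
remove-++ x = filter-++ (λ y → ¬? (y ≟ x))

remove-++-fresh : ∀ {x} A {B} → x ∉ B → remove x (A ++ B) ≡ remove x A ++ B
remove-++-fresh {x} A {B} x∉B =
  trans (remove-++ x A B) (cong (remove x A ++_) (remove-fresh B x∉B))

remove-comm-head : ∀ x y l → remove x (remove y l) ≡ remove y (remove x l) →
                   remove x (remove y (x ∷ l)) ≡ remove y (remove x (x ∷ l))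
remove-comm-head x y l ih with x ≟ y
... | yes refl = refl
... | no x≢y = begin
  remove x (remove y (x ∷ l))  ≡⟨ cong (remove x) (remove-other l x≢y) ⟩
  remove x (x ∷ remove y l)    ≡⟨ remove-self x _ ⟩
  remove x (remove y l)        ≡⟨ ih ⟩
  remove y (remove x l)        ≡⟨ cong (remove y) (remove-self x l) ⟨
  remove y (remove x (x ∷ l))  ∎
  where open ≡-Reasoning

remove-comm : ∀ x y l → remove x (remove y l) ≡ remove y (remove x l)
remove-comm x y [] = refl
remove-comm x y (z ∷ l) with z ≟ x | z ≟ y
... | yes refl | _      = remove-comm-head z y l (remove-comm z y l)
... | no _ | yes refl   = sym (remove-comm-head z x l (sym (remove-comm x z l)))
... | no z≢x | no z≢y = begin
  remove x (remove y (z ∷ l))  ≡⟨ cong (remove x) (remove-other l z≢y) ⟩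
  remove x (z ∷ remove y l)    ≡⟨ remove-other _ z≢x ⟩
  z ∷ remove x (remove y l)    ≡⟨ cong (z ∷_) (remove-comm x y l) ⟩
  z ∷ remove y (remove x l)    ≡⟨ remove-other _ z≢y ⟨
  remove y (z ∷ remove x l)    ≡⟨ cong (remove y) (remove-other l z≢x) ⟨
  remove y (remove x (z ∷ l))  ∎
  where open ≡-Reasoning

-- Set equality of variable lists: the relation between the free variable
-- lists of a term and of its reducts.
infix 4 _≋_
_≋_ : List Var → List Var → Set
A ≋ B = A ⊆ B × B ⊆ A

≡⇒≋ : ∀ {A B} → A ≡ B → A ≋ B
≡⇒≋ refl = ⊆-refl , ⊆-refl

≋-trans : ∀ {A B C} → A ≋ B → B ≋ C → A ≋ C
≋-trans (A⊆B , B⊆A) (B⊆C , C⊆B) = ⊆-trans A⊆B B⊆C , ⊆-trans C⊆B B⊆A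

∷-cong-≋ : ∀ {x A B} → A ≋ B → x ∷ A ≋ x ∷ B
∷-cong-≋ {x} (A⊆B , B⊆A) = ∷⁺ʳ x A⊆B , ∷⁺ʳ x B⊆A

++-cong-≋ : ∀ {A A' B B'} → A ≋ A' → B ≋ B' → A ++ B ≋ A' ++ B'
++-cong-≋ (A⊆ , ⊇A) (B⊆ , ⊇B) = ++⁺ A⊆ B⊆ , ++⁺ ⊇A ⊇B

remove-cong-≋ : ∀ {x A B} → A ≋ B → remove x A ≋ remove x B
remove-cong-≋ (A⊆B , B⊆A) = remove-⊆ A⊆B , remove-⊆ B⊆A

++-comm-⊆ : ∀ (A B : List Var) → A ++ B ⊆ B ++ A
++-comm-⊆ A B z∈ with ∈-++⁻ A z∈
... | inj₁ z∈A = ∈-++⁺ʳ B z∈A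
... | inj₂ z∈B = ∈-++⁺ˡ z∈B

++-comm-≋ : ∀ (A B : List Var) → A ++ B ≋ B ++ A
++-comm-≋ A B = ++-comm-⊆ A B , ++-comm-⊆ B A

≋-sym : ∀ {A B} → A ≋ B → B ≋ A
≋-sym = Product.swap

++-exchange-≋ : ∀ (A B C : List Var) → (A ++ B) ++ C ≋ (A ++ C) ++ B
++-exchange-≋ A B C =
  ≋-trans (≡⇒≋ (++-assoc A B C))
          (≋-trans (++-cong-≋ (≡⇒≋ {A} refl) (++-comm-≋ B C)) (≡⇒≋ (sym (++-assoc A C B))))

disjoint-sym : ∀ {A B} → Disjoint A B → Disjoint B A
disjoint-sym d z∈B z∈A = d z∈A z∈B

disjoint-⊆ : ∀ {A A' B B'} → A' ⊆ A → B' ⊆ B → Disjoint A B → Disjoint A' B'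
disjoint-⊆ A'⊆A B'⊆B d z∈A' z∈B' = d (A'⊆A z∈A') (B'⊆B z∈B')

disjoint-⊆ˡ : ∀ {A A' B} → A' ⊆ A → Disjoint A B → Disjoint A' B
disjoint-⊆ˡ A'⊆A = disjoint-⊆ A'⊆A ⊆-refl

disjoint-++ : ∀ {A B C : List Var} → Disjoint A C → Disjoint B C → Disjoint (A ++ B) C
disjoint-++ {A} dA dB z∈ with ∈-++⁻ A z∈
... | inj₁ z∈A = dA z∈A
... | inj₂ z∈B = dB z∈B

disjoint-remove : ∀ {y A B} → y ∉ B → Disjoint (remove y A) B → Disjoint A B
disjoint-remove {y} y∉B d z∈A z∈B =
  d (∈-remove⁺ z∈A (λ z≡y → y∉B (subst (_∈ _) z≡y z∈B))) z∈B

∈-tail : ∀ {x y : Var} {A} → x ∈ y ∷ A → x ≢ y → x ∈ A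
∈-tail (here x≡y) x≢y = ⊥-elim (x≢y x≡y)
∈-tail (there x∈A) _  = x∈A

∉-++ : ∀ {x : Var} {A B : List Var} → x ∉ A → x ∉ B → x ∉ A ++ B
∉-++ {A = A} x∉A x∉B x∈ with ∈-++⁻ A x∈
... | inj₁ x∈A = x∉A x∈A
... | inj₂ x∈B = x∉B x∈B

unique-∷ : ∀ {x : Var} {A} → x ∉ A → Unique A → Unique (x ∷ A)
unique-∷ x∉A uA = ¬Any⇒All¬ _ x∉A ∷ uA

unique-head : ∀ {x : Var} {A} → Unique (x ∷ A) → x ∉ A
unique-head = Unique.Unique[x∷xs]⇒x∉xs

unique-++ : ∀ {A B} → Unique A → Unique B → Disjoint A B → Unique (A ++ B)
unique-++ uA uB d = Unique.++⁺ uA uB (λ (z∈A , z∈B) → d z∈A z∈B)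

unique-++⁻ : ∀ (A : List Var) {B} → Unique (A ++ B) → Unique A × Unique B × Disjoint A B
unique-++⁻ [] uB = [] , uB , λ ()
unique-++⁻ (x ∷ A) (x∉ ∷ uAB) =
  let uA , uB , d = unique-++⁻ A uAB
      x∉A++B : x ∉ A ++ _
      x∉A++B = All¬⇒¬Any x∉
  in  unique-∷ (λ x∈A → x∉A++B (∈-++⁺ˡ x∈A)) uA , uB ,
      λ { (here refl) z∈B → x∉A++B (∈-++⁺ʳ A z∈B) ; (there z∈A) z∈B → d z∈A z∈B }

unique-remove : ∀ x {A} → Unique A → Unique (remove x A)
unique-remove x = Unique.filter⁺ (λ y → ¬? (y ≟ x))

remove-map : ∀ (f g : Var → Var) {x x'} l →
             (∀ {z} → z ∈ l → z ≡ x → g z ≡ x') →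
             (∀ {z} → z ∈ l → z ≢ x → g z ≡ f z × f z ≢ x') →
             remove x' (map g l) ≡ map f (remove x l)
remove-map f g [] hit miss = refl
remove-map f g {x} {x'} (z ∷ l) hit miss with z ≟ x
... | yes refl = begin
  remove x' (g x ∷ map g l)  ≡⟨ cong (λ w → remove x' (w ∷ map g l)) (hit (here refl) refl) ⟩
  remove x' (x' ∷ map g l)   ≡⟨ remove-self x' _ ⟩
  remove x' (map g l)        ≡⟨ ih ⟩
  map f (remove x l)         ≡⟨ cong (map f) (remove-self x l) ⟨
  map f (remove x (x ∷ l))   ∎
  where
  open ≡-Reasoning
  ih = remove-map f g l (hit ∘ there) (miss ∘ there)
... | no z≢x = begin
  remove x' (g z ∷ map g l)  ≡⟨ cong (λ w → remove x' (w ∷ map g l)) gz≡fz ⟩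
  remove x' (f z ∷ map g l)  ≡⟨ remove-other _ fz≢x' ⟩
  f z ∷ remove x' (map g l)  ≡⟨ cong (f z ∷_) ih ⟩
  map f (z ∷ remove x l)     ≡⟨ cong (map f) (remove-other l z≢x) ⟨
  map f (remove x (z ∷ l))   ∎
  where
  open ≡-Reasoning
  ih = remove-map f g l (hit ∘ there) (miss ∘ there)
  gz≡fz = proj₁ (miss (here refl) z≢x)
  fz≢x' = proj₂ (miss (here refl) z≢x)

remove-map-injective : ∀ (f : Var → Var) → Injective _≡_ _≡_ f →
                       ∀ x l → remove (f x) (map f l) ≡ map f (remove x l)
remove-map-injective f f-inj x l =
  remove-map f f l (λ _ → cong f) (λ _ z≢x → refl , λ fz≡fx → z≢x (f-inj fz≡fx))

InjectiveOn : (Var → Var) → List Var → Set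
InjectiveOn f T = ∀ {u v} → u ∈ T → v ∈ T → f u ≡ f v → u ≡ v

∉-map : ∀ {f T x A} → InjectiveOn f T → x ∈ T → A ⊆ T → x ∉ A → f x ∉ map f A
∉-map f-inj x∈T A⊆T x∉A fx∈ with ∈-map⁻ _ fx∈
... | a , a∈A , fx≡fa = x∉A (subst (_∈ _) (sym (f-inj x∈T (A⊆T a∈A) fx≡fa)) a∈A)

disjoint-map : ∀ {f T A B} → InjectiveOn f T → A ⊆ T → B ⊆ T →
               Disjoint A B → Disjoint (map f A) (map f B)
disjoint-map f-inj A⊆T B⊆T d z∈fA z∈fB with ∈-map⁻ _ z∈fA
... | a , a∈A , refl = ∉-map f-inj (A⊆T a∈A) B⊆T (λ a∈B → d a∈A a∈B) z∈fB

∉-map-injective : ∀ {f : Var → Var} → Injective _≡_ _≡_ f → ∀ {x A} → x ∉ A → f x ∉ map f A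
∉-map-injective f-inj = ∉-map (λ _ _ → f-inj) (here refl) there

disjoint-map-injective : ∀ {f : Var → Var} → Injective _≡_ _≡_ f →
                         ∀ {A B} → Disjoint A B → Disjoint (map f A) (map f B)
disjoint-map-injective f-inj {A} {B} =
  disjoint-map (λ _ _ → f-inj) (xs⊆xs++ys A B) (xs⊆ys++xs B A)

-- Terms without explicit substitution: Λ_® is exactly the substitution-free
-- part of Λ_®^{[/]}.
SubFree : Term → Set
SubFree (var x)         = ⊤
SubFree (lam x M)       = SubFree M
SubFree (app M N)       = SubFree M × SubFree N
SubFree (era x M)       = SubFree M
SubFree (dup x x₁ x₂ M) = SubFree M
SubFree (sub M N x)     = ⊥

WF₀⇒WF : ∀ {M} → WF₀ M → WF M
WF₀⇒WF (var x)                   = var x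
WF₀⇒WF (lam w x∈)                = lam (WF₀⇒WF w) x∈
WF₀⇒WF (app w v d)               = app (WF₀⇒WF w) (WF₀⇒WF v) d
WF₀⇒WF (era w x∉)                = era (WF₀⇒WF w) x∉
WF₀⇒WF (dup w x₁∈ x₂∈ x₁≢x₂ x∉) = dup (WF₀⇒WF w) x₁∈ x₂∈ x₁≢x₂ x∉

WF₀⇒SubFree : ∀ {M} → WF₀ M → SubFree M
WF₀⇒SubFree (var x)         = tt
WF₀⇒SubFree (lam w _)       = WF₀⇒SubFree w
WF₀⇒SubFree (app w v _)     = WF₀⇒SubFree w , WF₀⇒SubFree v
WF₀⇒SubFree (era w _)       = WF₀⇒SubFree w
WF₀⇒SubFree (dup w _ _ _ _) = WF₀⇒SubFree w

WF⇒WF₀ : ∀ {M} → WF M → SubFree M → WF₀ M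
WF⇒WF₀ (var x) _                   = var x
WF⇒WF₀ (lam w x∈) s                = lam (WF⇒WF₀ w s) x∈
WF⇒WF₀ (app w v d) (s , t)         = app (WF⇒WF₀ w s) (WF⇒WF₀ v t) d
WF⇒WF₀ (era w x∉) s                = era (WF⇒WF₀ w s) x∉
WF⇒WF₀ (dup w x₁∈ x₂∈ x₁≢x₂ x∉) s = dup (WF⇒WF₀ w s) x₁∈ x₂∈ x₁≢x₂ x∉

fv-unique : ∀ {M} → WF₀ M → Unique (fv M)
fv-unique (var x)                     = [] ∷ []
fv-unique {lam x _} (lam w _)         = unique-remove x (fv-unique w)
fv-unique (app w v d)                 = unique-++ (fv-unique w) (fv-unique v) d
fv-unique (era w x∉)                  = unique-∷ x∉ (fv-unique w)
fv-unique {dup _ x₁ x₂ _} (dup w _ _ _ x∉) =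
  unique-∷ x∉ (unique-remove x₂ (unique-remove x₁ (fv-unique w)))

SubFree-irreducible : ∀ {M N} → SubFree M → ¬ (M ⟶c N)
SubFree-irreducible () (c-base r-var)
SubFree-irreducible () (c-base (r-lam _ _))
SubFree-irreducible () (c-base (r-appˡ _))
SubFree-irreducible () (c-base (r-appʳ _))
SubFree-irreducible () (c-base (r-era _))
SubFree-irreducible () (c-base r-eraₓ)
SubFree-irreducible () (c-base (r-dup _ _ _))
SubFree-irreducible () (c-base (r-dupₓ _ _ _ _ _ _))
SubFree-irreducible s (c-lam c)             = SubFree-irreducible s c
SubFree-irreducible (s , _) (c-appˡ c)      = SubFree-irreducible s c
SubFree-irreducible (_ , s) (c-appʳ c)      = SubFree-irreducible s c
SubFree-irreducible s (c-era c)             = SubFree-irreducible s c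
SubFree-irreducible s (c-dup c)             = SubFree-irreducible s c

fv⊆allVars : ∀ M → fv M ⊆ allVars M
fv⊆allVars (var x) z∈ = z∈
fv⊆allVars (lam x M) z∈ = there (fv⊆allVars M (proj₁ (∈-remove⁻ (fv M) z∈)))
fv⊆allVars (app M N) z∈ = ++⁺ (fv⊆allVars M) (fv⊆allVars N) z∈
fv⊆allVars (era x M) z∈ = ∷⁺ʳ x (fv⊆allVars M) z∈
fv⊆allVars (dup x x₁ x₂ M) (here z≡x) = here z≡x
fv⊆allVars (dup x x₁ x₂ M) (there z∈) =
  there (there (there (fv⊆allVars M (proj₁ (∈-remove⁻ (fv M) (proj₁ (∈-remove⁻ _ z∈)))))))
fv⊆allVars (sub M N x) z∈ =
  there (++⁺ (fv⊆allVars M ∘ proj₁ ∘ ∈-remove⁻ (fv M)) (fv⊆allVars N) z∈)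

infix 4 _⊑_
_⊑_ : Term → Term → Set
M ⊑ N = WF M → WF N × fv M ≋ fv N

⊑-refl : ∀ {M} → M ⊑ M
⊑-refl w = w , ≡⇒≋ refl

⊑-trans : ∀ {M N P} → M ⊑ N → N ⊑ P → M ⊑ P
⊑-trans M⊑N N⊑P w =
  let w' , M≋N = M⊑N w ; w'' , N≋P = N⊑P w' in w'' , ≋-trans M≋N N≋P

-- ⊑ is a congruence for all term constructors; below an explicit
-- substitution the replaced term must moreover stay substitution-free.
⊑-lam : ∀ {x M M'} → M ⊑ M' → lam x M ⊑ lam x M'
⊑-lam M⊑M' (lam w x∈) =
  let w' , M≋M' = M⊑M' w in lam w' (proj₁ M≋M' x∈) , remove-cong-≋ M≋M'

⊑-appˡ : ∀ {M M' N} → M ⊑ M' → app M N ⊑ app M' N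
⊑-appˡ M⊑M' (app w v d) =
  let w' , M≋M' = M⊑M' w in app w' v (disjoint-⊆ˡ (proj₂ M≋M') d) , ++-cong-≋ M≋M' (≡⇒≋ refl)

⊑-appʳ : ∀ {M N N'} → N ⊑ N' → app M N ⊑ app M N'
⊑-appʳ N⊑N' (app w v d) =
  let v' , N≋N' = N⊑N' v
  in  app w v' (disjoint-⊆ ⊆-refl (proj₂ N≋N') d) , ++-cong-≋ (≡⇒≋ refl) N≋N'

⊑-era : ∀ {x M M'} → M ⊑ M' → era x M ⊑ era x M'
⊑-era M⊑M' (era w x∉) =
  let w' , M≋M' = M⊑M' w in era w' (x∉ ∘ proj₂ M≋M') , ∷-cong-≋ M≋M'

⊑-dup : ∀ {x x₁ x₂ M M'} → M ⊑ M' → dup x x₁ x₂ M ⊑ dup x x₁ x₂ M'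
⊑-dup M⊑M' (dup w x₁∈ x₂∈ x₁≢x₂ x∉) =
  let w' , M≋M' = M⊑M' w
      R≋R' = remove-cong-≋ (remove-cong-≋ M≋M')
  in  dup w' (proj₁ M≋M' x₁∈) (proj₁ M≋M' x₂∈) x₁≢x₂ (x∉ ∘ proj₂ R≋R') , ∷-cong-≋ R≋R'

⊑-subˡ : ∀ {M M' N x} → M ⊑ M' → sub M N x ⊑ sub M' N x
⊑-subˡ M⊑M' (sub w x∈ w₀ d) =
  let w' , M≋M' = M⊑M' w
      R≋R' = remove-cong-≋ M≋M'
  in  sub w' (proj₁ M≋M' x∈) w₀ (disjoint-⊆ˡ (proj₂ R≋R') d) , ++-cong-≋ R≋R' (≡⇒≋ refl)

⊑-subʳ : ∀ {M N N' x} → (SubFree N → SubFree N') → N ⊑ N' → sub M N x ⊑ sub M N' x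
⊑-subʳ keepsSubFree N⊑N' (sub w x∈ w₀ d) =
  let v' , N≋N' = N⊑N' (WF₀⇒WF w₀)
  in  sub w x∈ (WF⇒WF₀ v' (keepsSubFree (WF₀⇒SubFree w₀)))
          (disjoint-⊆ ⊆-refl (proj₂ N≋N') d) ,
      ++-cong-≋ (≡⇒≋ refl) N≋N'

swapVar-left : ∀ a b → swapVar a b a ≡ b
swapVar-left a b =
  cong (λ c → if c then b else (if does (a ≟ b) then a else a)) (dec-true (a ≟ a) refl)

swapVar-≢ : ∀ {a b z} → z ≢ a → swapVar a b z ≡ (if does (z ≟ b) then a else z)
swapVar-≢ {a} {b} {z} z≢a =
  cong (λ c → if c then b else (if does (z ≟ b) then a else z)) (dec-false (z ≟ a) z≢a)

swapVar-right : ∀ a b → swapVar a b b ≡ a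
swapVar-right a b with b ≟ a
... | yes refl = swapVar-left a a
... | no b≢a =
  trans (swapVar-≢ b≢a) (cong (λ c → if c then a else b) (dec-true (b ≟ b) refl))

swapVar-other : ∀ {a b z} → z ≢ a → z ≢ b → swapVar a b z ≡ z
swapVar-other {a} {b} {z} z≢a z≢b =
  trans (swapVar-≢ z≢a) (cong (λ c → if c then a else z) (dec-false (z ≟ b) z≢b))

swapVar-involutive : ∀ a b z → swapVar a b (swapVar a b z) ≡ z
swapVar-involutive a b z with z ≟ a | z ≟ b
... | yes refl | _ = trans (cong (swapVar a b) (swapVar-left a b)) (swapVar-right a b)
... | no _ | yes refl = trans (cong (swapVar a b) (swapVar-right a b)) (swapVar-left a b)
... | no z≢a | no z≢b =
  trans (cong (swapVar a b) (swapVar-other z≢a z≢b)) (swapVar-other z≢a z≢b)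

swapVar-injective : ∀ a b {u v} → swapVar a b u ≡ swapVar a b v → u ≡ v
swapVar-injective a b {u} {v} e =
  begin
    u                                ≡⟨ swapVar-involutive a b u ⟨
    swapVar a b (swapVar a b u)      ≡⟨ cong (swapVar a b) e ⟩
    swapVar a b (swapVar a b v)      ≡⟨ swapVar-involutive a b v ⟩
    v                                ∎
  where open ≡-Reasoning

module _ (a b : Var) where
  private
    σ : Var → Var
    σ = swapVar a b
    σ-inj : Injective _≡_ _≡_ σ
    σ-inj = swapVar-injective a b

  fv-swap : ∀ M → fv (swap a b M) ≡ map σ (fv M)
  fv-swap-remove : ∀ x M → remove (σ x) (fv (swap a b M)) ≡ map σ (remove x (fv M))

  fv-swap (var x)         = refl
  fv-swap (lam x M)       = fv-swap-remove x M
  fv-swap (app M N)       =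
    trans (cong₂ _++_ (fv-swap M) (fv-swap N)) (sym (map-++ σ (fv M) (fv N)))
  fv-swap (era x M)       = cong (σ x ∷_) (fv-swap M)
  fv-swap (dup x x₁ x₂ M) =
    cong (σ x ∷_) (trans (cong (remove (σ x₂)) (fv-swap-remove x₁ M))
                         (remove-map-injective σ σ-inj x₂ (remove x₁ (fv M))))
  fv-swap (sub M N x)     = trans (cong₂ _++_ (fv-swap-remove x M) (fv-swap N))
                                  (sym (map-++ σ (remove x (fv M)) (fv N)))

  fv-swap-remove x M = trans (cong (remove (σ x)) (fv-swap M))
                             (remove-map-injective σ σ-inj x (fv M))

  ∈-swap : ∀ M {w} → w ∈ fv M → σ w ∈ fv (swap a b M)
  ∈-swap M {w} w∈ = subst (σ w ∈_) (sym (fv-swap M)) (∈-map⁺ σ w∈)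

  swap-involutive : ∀ M → swap a b (swap a b M) ≡ M
  swap-involutive (var x)         = cong var (swapVar-involutive a b x)
  swap-involutive (lam x M)       = cong₂ lam (swapVar-involutive a b x) (swap-involutive M)
  swap-involutive (app M N)       = cong₂ app (swap-involutive M) (swap-involutive N)
  swap-involutive (era x M)       = cong₂ era (swapVar-involutive a b x) (swap-involutive M)
  swap-involutive (dup x x₁ x₂ M)
    rewrite swapVar-involutive a b x | swapVar-involutive a b x₁ | swapVar-involutive a b x₂
          | swap-involutive M = refl
  swap-involutive (sub M N x)
    rewrite swap-involutive M | swap-involutive N | swapVar-involutive a b x = refl

  swap-SubFree : ∀ M → SubFree M → SubFree (swap a b M)
  swap-SubFree (var x) _         = tt
  swap-SubFree (lam x M) s       = swap-SubFree M s
  swap-SubFree (app M N) (s , t) = swap-SubFree M s , swap-SubFree N t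
  swap-SubFree (era x M) s       = swap-SubFree M s
  swap-SubFree (dup x x₁ x₂ M) s = swap-SubFree M s

  -- Swapping preserves well-formedness, since σ is injective; the binder
  -- conditions are transported along fv-swap.
  swap-WF : ∀ {M} → WF M → WF (swap a b M)
  swap-WF (var x) = var (σ x)
  swap-WF {lam x M} (lam w x∈) = lam (swap-WF w) (∈-swap M x∈)
  swap-WF {app M N} (app w v d) =
    app (swap-WF w) (swap-WF v)
        (subst₂ Disjoint (sym (fv-swap M)) (sym (fv-swap N)) (disjoint-map-injective σ-inj d))
  swap-WF {era x M} (era w x∉) =
    era (swap-WF w) (subst (σ x ∉_) (sym (fv-swap M)) (∉-map-injective σ-inj x∉))
  swap-WF {dup x x₁ x₂ M} (dup w x₁∈ x₂∈ x₁≢x₂ x∉) =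
    dup (swap-WF w) (∈-swap M x₁∈) (∈-swap M x₂∈) (x₁≢x₂ ∘ σ-inj)
        (subst (σ x ∉_) (sym (∷-injectiveʳ (fv-swap (dup x x₁ x₂ M))))
               (∉-map-injective σ-inj x∉))
  swap-WF {sub M N x} (sub w x∈ w₀ d) =
    sub (swap-WF w) (∈-swap M x∈)
        (WF⇒WF₀ (swap-WF (WF₀⇒WF w₀)) (swap-SubFree N (WF₀⇒SubFree w₀)))
        (subst₂ Disjoint (sym (fv-swap-remove x M)) (sym (fv-swap N))
                (disjoint-map-injective σ-inj d))

swap-WF⁻ : ∀ a b {M} → WF (swap a b M) → WF M
swap-WF⁻ a b {M} w = subst WF (swap-involutive a b M) (swap-WF a b w)

swap-SubFree⁻ : ∀ a b M → SubFree (swap a b M) → SubFree M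
swap-SubFree⁻ a b M s = subst SubFree (swap-involutive a b M) (swap-SubFree a b (swap a b M) s)

∈-swap⁻ : ∀ a b M {w} → w ∈ fv (swap a b M) → swapVar a b w ∈ fv M
∈-swap⁻ a b M {w} w∈ =
  subst (λ N → swapVar a b w ∈ fv N) (swap-involutive a b M) (∈-swap a b (swap a b M) w∈)

remove-swap : ∀ x y M → y ∉ fv M → remove y (fv (swap x y M)) ≡ remove x (fv M)
remove-swap x y M y∉ = begin
  remove y (fv (swap x y M))                ≡⟨ cong (λ v → remove v L) (swapVar-left x y) ⟨
  remove (swapVar x y x) (fv (swap x y M))  ≡⟨ fv-swap-remove x y x M ⟩
  map (swapVar x y) (remove x (fv M))       ≡⟨ map-id-local (All.tabulate unmoved) ⟩
  remove x (fv M)                           ∎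
  where
  open ≡-Reasoning
  L = fv (swap x y M)
  unmoved : ∀ {z} → z ∈ remove x (fv M) → swapVar x y z ≡ z
  unmoved z∈ = let z∈M , z≢x = ∈-remove⁻ (fv M) z∈
               in  swapVar-other z≢x (λ z≡y → y∉ (subst (_∈ fv M) z≡y z∈M))

α-λ-⊑ : ∀ {x y M} → y ∉ fv M →
        lam x M ⊑ lam y (swap x y M) × lam y (swap x y M) ⊑ lam x M
α-λ-⊑ {x} {y} {M} y∉ = forward , backward
  where
  forward : lam x M ⊑ lam y (swap x y M)
  forward (lam w x∈) =
    lam (swap-WF x y w) (subst (_∈ fv (swap x y M)) (swapVar-left x y) (∈-swap x y M x∈)) ,
    ≡⇒≋ (sym (remove-swap x y M y∉))
  backward : lam y (swap x y M) ⊑ lam x M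
  backward (lam w y∈) =
    lam (swap-WF⁻ x y w) (subst (_∈ fv M) (swapVar-right x y) (∈-swap⁻ x y M y∈)) ,
    ≡⇒≋ (remove-swap x y M y∉)

α-dup₁-⊑ : ∀ {x x₁ x₂ y M} → y ∉ fv M → y ≢ x₂ →
           dup x x₁ x₂ M ⊑ dup x y x₂ (swap x₁ y M) ×
           dup x y x₂ (swap x₁ y M) ⊑ dup x x₁ x₂ M
α-dup₁-⊑ {x} {x₁} {x₂} {y} {M} y∉ y≢x₂ = forward , backward
  where
  bodies : remove x₂ (remove y (fv (swap x₁ y M))) ≡ remove x₂ (remove x₁ (fv M))
  bodies = cong (remove x₂) (remove-swap x₁ y M y∉)
  forward : dup x x₁ x₂ M ⊑ dup x y x₂ (swap x₁ y M)
  forward (dup w x₁∈ x₂∈ x₁≢x₂ x∉) =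
    dup (swap-WF x₁ y w)
        (subst (_∈ fv (swap x₁ y M)) (swapVar-left x₁ y) (∈-swap x₁ y M x₁∈))
        (subst (_∈ fv (swap x₁ y M)) (swapVar-other (≢-sym x₁≢x₂) (≢-sym y≢x₂))
               (∈-swap x₁ y M x₂∈))
        y≢x₂ (subst (x ∉_) (sym bodies) x∉) ,
    ≡⇒≋ (cong (x ∷_) (sym bodies))
  backward : dup x y x₂ (swap x₁ y M) ⊑ dup x x₁ x₂ M
  backward (dup w y∈ x₂∈ _ x∉) =
    let x₂∈M , x₂≢x₁ = ∈-remove⁻ (fv M) (subst (x₂ ∈_) (remove-swap x₁ y M y∉)
                                               (∈-remove⁺ x₂∈ (≢-sym y≢x₂)))
    in  dup (swap-WF⁻ x₁ y w) (subst (_∈ fv M) (swapVar-right x₁ y) (∈-swap⁻ x₁ y M y∈))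
            x₂∈M (≢-sym x₂≢x₁) (subst (x ∉_) bodies x∉) ,
        ≡⇒≋ (cong (x ∷_) bodies)

α-dup₂-⊑ : ∀ {x x₁ x₂ y M} → y ∉ fv M → y ≢ x₁ →
           dup x x₁ x₂ M ⊑ dup x x₁ y (swap x₂ y M) ×
           dup x x₁ y (swap x₂ y M) ⊑ dup x x₁ x₂ M
α-dup₂-⊑ {x} {x₁} {x₂} {y} {M} y∉ y≢x₁ = forward , backward
  where
  bodies : remove y (remove x₁ (fv (swap x₂ y M))) ≡ remove x₂ (remove x₁ (fv M))
  bodies = begin
    remove y (remove x₁ (fv (swap x₂ y M)))  ≡⟨ remove-comm y x₁ (fv (swap x₂ y M)) ⟩
    remove x₁ (remove y (fv (swap x₂ y M)))  ≡⟨ cong (remove x₁) (remove-swap x₂ y M y∉) ⟩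
    remove x₁ (remove x₂ (fv M))             ≡⟨ remove-comm x₁ x₂ (fv M) ⟩
    remove x₂ (remove x₁ (fv M))             ∎
    where open ≡-Reasoning
  forward : dup x x₁ x₂ M ⊑ dup x x₁ y (swap x₂ y M)
  forward (dup w x₁∈ x₂∈ x₁≢x₂ x∉) =
    dup (swap-WF x₂ y w)
        (subst (_∈ fv (swap x₂ y M)) (swapVar-other x₁≢x₂ (≢-sym y≢x₁)) (∈-swap x₂ y M x₁∈))
        (subst (_∈ fv (swap x₂ y M)) (swapVar-left x₂ y) (∈-swap x₂ y M x₂∈))
        (≢-sym y≢x₁) (subst (x ∉_) (sym bodies) x∉) ,
    ≡⇒≋ (cong (x ∷_) (sym bodies))
  backward : dup x x₁ y (swap x₂ y M) ⊑ dup x x₁ x₂ M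
  backward (dup w x₁∈ y∈ x₁≢y x∉) =
    let x₁∈M , x₁≢x₂ = ∈-remove⁻ (fv M) (subst (x₁ ∈_) (remove-swap x₂ y M y∉)
                                               (∈-remove⁺ x₁∈ x₁≢y))
    in  dup (swap-WF⁻ x₂ y w) x₁∈M (subst (_∈ fv M) (swapVar-right x₂ y) (∈-swap⁻ x₂ y M y∈))
            x₁≢x₂ (subst (x ∉_) bodies x∉) ,
        ≡⇒≋ (cong (x ∷_) bodies)

α-sub-⊑ : ∀ {x y M N} → y ∉ fv M →
          sub M N x ⊑ sub (swap x y M) N y × sub (swap x y M) N y ⊑ sub M N x
α-sub-⊑ {x} {y} {M} {N} y∉ = forward , backward
  where
  forward : sub M N x ⊑ sub (swap x y M) N y
  forward (sub w x∈ w₀ d) =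
    sub (swap-WF x y w) (subst (_∈ fv (swap x y M)) (swapVar-left x y) (∈-swap x y M x∈)) w₀
        (subst (λ L → Disjoint L (fv N)) (sym (remove-swap x y M y∉)) d) ,
    ≡⇒≋ (cong (_++ fv N) (sym (remove-swap x y M y∉)))
  backward : sub (swap x y M) N y ⊑ sub M N x
  backward (sub w y∈ w₀ d) =
    sub (swap-WF⁻ x y w) (subst (_∈ fv M) (swapVar-right x y) (∈-swap⁻ x y M y∈)) w₀
        (subst (λ L → Disjoint L (fv N)) (remove-swap x y M y∉) d) ,
    ≡⇒≋ (cong (_++ fv N) (remove-swap x y M y∉))

-- α-equivalent terms are equally substitution-free (needed below [N/x]) ...
α-SubFree : ∀ {M N} → M ≈α N → (SubFree M → SubFree N) × (SubFree N → SubFree M)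
α-SubFree α-refl        = id , id
α-SubFree (α-sym p)     = Product.swap (α-SubFree p)
α-SubFree (α-trans p q) = let to₁ , from₁ = α-SubFree p ; to₂ , from₂ = α-SubFree q
                          in  to₂ ∘ to₁ , from₁ ∘ from₂
α-SubFree (α-lam p)     = α-SubFree p
α-SubFree (α-appˡ p)    = let to , from = α-SubFree p in Product.map₁ to , Product.map₁ from
α-SubFree (α-appʳ p)    = let to , from = α-SubFree p in Product.map₂ to , Product.map₂ from
α-SubFree (α-era p)     = α-SubFree p
α-SubFree (α-dup p)     = α-SubFree p
α-SubFree (α-subˡ p)    = (λ ()) , (λ ())
α-SubFree (α-subʳ p)    = (λ ()) , (λ ())
α-SubFree (α-λ {x} {y} {M} _)              = swap-SubFree x y M , swap-SubFree⁻ x y M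
α-SubFree (α-dup₁ {x₁ = x₁} {y = y} {M} _ _) = swap-SubFree x₁ y M , swap-SubFree⁻ x₁ y M
α-SubFree (α-dup₂ {x₂ = x₂} {y = y} {M} _ _) = swap-SubFree x₂ y M , swap-SubFree⁻ x₂ y M
α-SubFree (α-sub _)     = (λ ()) , (λ ())

α-⊑ : ∀ {M N} → M ≈α N → M ⊑ N × N ⊑ M
α-⊑ α-refl         = ⊑-refl , ⊑-refl
α-⊑ (α-sym p)      = Product.swap (α-⊑ p)
α-⊑ (α-trans p q)  = let M⊑N , N⊑M = α-⊑ p ; N⊑P , P⊑N = α-⊑ q
                     in  ⊑-trans M⊑N N⊑P , ⊑-trans P⊑N N⊑M
α-⊑ (α-lam p)      = Product.map ⊑-lam ⊑-lam (α-⊑ p)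
α-⊑ (α-appˡ p)     = Product.map ⊑-appˡ ⊑-appˡ (α-⊑ p)
α-⊑ (α-appʳ p)     = Product.map ⊑-appʳ ⊑-appʳ (α-⊑ p)
α-⊑ (α-era p)      = Product.map ⊑-era ⊑-era (α-⊑ p)
α-⊑ (α-dup p)      = Product.map ⊑-dup ⊑-dup (α-⊑ p)
α-⊑ (α-subˡ p)     = Product.map ⊑-subˡ ⊑-subˡ (α-⊑ p)
α-⊑ (α-subʳ p)     = let to , from = α-SubFree p ; N⊑N' , N'⊑N = α-⊑ p
                     in  ⊑-subʳ to N⊑N' , ⊑-subʳ from N'⊑N
α-⊑ (α-λ y∉)       = α-λ-⊑ y∉
α-⊑ (α-dup₁ y∉ y≢) = α-dup₁-⊑ y∉ y≢
α-⊑ (α-dup₂ y∉ y≢) = α-dup₂-⊑ y∉ y≢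
α-⊑ (α-sub y∉)     = α-sub-⊑ y∉

lookup-hit : ∀ a b ρ → lookupRen ((a , b) ∷ ρ) a ≡ b
lookup-hit a b ρ = cong (λ c → if c then b else lookupRen ρ a) (dec-true (a ≟ a) refl)

lookup-miss : ∀ {a b z} ρ → z ≢ a → lookupRen ((a , b) ∷ ρ) z ≡ lookupRen ρ z
lookup-miss {a} {b} {z} ρ z≢a =
  cong (λ c → if c then b else lookupRen ρ z) (dec-false (z ≟ a) z≢a)

dropRen-skip : ∀ {x b} ρ → dropRen x ((x , b) ∷ ρ) ≡ dropRen x ρ
dropRen-skip {x} ρ = filter-reject (λ p → ¬? (proj₁ p ≟ x)) (λ x≢x → x≢x refl)

dropRen-keep : ∀ {x a b} ρ → a ≢ x → dropRen x ((a , b) ∷ ρ) ≡ (a , b) ∷ dropRen x ρ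
dropRen-keep {x} ρ = filter-accept (λ p → ¬? (proj₁ p ≟ x))

lookup-drop-self : ∀ x ρ → lookupRen (dropRen x ρ) x ≡ x
lookup-drop-self x [] = refl
lookup-drop-self x ((a , b) ∷ ρ) with a ≟ x
... | yes refl = trans (cong (λ ρ' → lookupRen ρ' x) (dropRen-skip ρ)) (lookup-drop-self x ρ)
... | no a≢x   = begin
  lookupRen (dropRen x ((a , b) ∷ ρ)) x  ≡⟨ cong (λ ρ' → lookupRen ρ' x) (dropRen-keep ρ a≢x) ⟩
  lookupRen ((a , b) ∷ dropRen x ρ) x    ≡⟨ lookup-miss (dropRen x ρ) (≢-sym a≢x) ⟩
  lookupRen (dropRen x ρ) x              ≡⟨ lookup-drop-self x ρ ⟩
  x                                      ∎
  where open ≡-Reasoning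

lookup-drop-other : ∀ {x} ρ {z} → z ≢ x → lookupRen (dropRen x ρ) z ≡ lookupRen ρ z
lookup-drop-other [] z≢x = refl
lookup-drop-other {x} ((a , b) ∷ ρ) {z} z≢x with a ≟ x
... | yes refl = begin
  lookupRen (dropRen x ((x , b) ∷ ρ)) z  ≡⟨ cong (λ ρ' → lookupRen ρ' z) (dropRen-skip ρ) ⟩
  lookupRen (dropRen x ρ) z              ≡⟨ lookup-drop-other ρ z≢x ⟩
  lookupRen ρ z                          ≡⟨ lookup-miss ρ z≢x ⟨
  lookupRen ((x , b) ∷ ρ) z              ∎
  where open ≡-Reasoning
... | no a≢x = begin
  lookupRen (dropRen x ((a , b) ∷ ρ)) z  ≡⟨ cong (λ ρ' → lookupRen ρ' z) (dropRen-keep ρ a≢x) ⟩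
  lookupRen ((a , b) ∷ dropRen x ρ) z    ≡⟨ cong (if_then_else_ (does (z ≟ a)) b) ih ⟩
  lookupRen ((a , b) ∷ ρ) z              ∎
  where
  open ≡-Reasoning
  ih = lookup-drop-other ρ z≢x

-- ρ renames the variables of T injectively, and each of them is either fixed
-- or sent outside T; then ρ can be pushed below binders ranging over T.
record Good (ρ : Ren) (T : List Var) : Set where
  field
    injective-on   : InjectiveOn (lookupRen ρ) T
    fixed-or-fresh : ∀ {u} → u ∈ T → lookupRen ρ u ≡ u ⊎ lookupRen ρ u ∉ T
open Good

good-⊆ : ∀ {ρ T T'} → T' ⊆ T → Good ρ T → Good ρ T'
good-⊆ T'⊆T g = record
  { injective-on   = λ u∈ v∈ → injective-on g (T'⊆T u∈) (T'⊆T v∈)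
  ; fixed-or-fresh = λ u∈ → Sum.map₂ (_∘ T'⊆T) (fixed-or-fresh g (T'⊆T u∈)) }

good-avoids : ∀ {ρ T z x} → Good ρ T → z ∈ T → x ∈ T → z ≢ x → lookupRen ρ z ≢ x
good-avoids {T = T} g z∈T x∈T z≢x ρz≡x with fixed-or-fresh g z∈T
... | inj₁ ρz≡z = z≢x (trans (sym ρz≡z) ρz≡x)
... | inj₂ ρz∉T = ρz∉T (subst (_∈ T) (sym ρz≡x) x∈T)

good-drop : ∀ {ρ T x} → x ∈ T → Good ρ T → Good (dropRen x ρ) T
good-drop {ρ} {T} {x} x∈T g = record { injective-on = injective ; fixed-or-fresh = fixed }
  where
  ρ' = lookupRen (dropRen x ρ)
  injective : InjectiveOn ρ' T
  injective {u} {v} u∈ v∈ e with u ≟ x | v ≟ x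
  ... | yes u≡x | yes v≡x = trans u≡x (sym v≡x)
  ... | yes refl | no v≢x = ⊥-elim (good-avoids g v∈ x∈T v≢x
    (trans (sym (lookup-drop-other ρ v≢x)) (trans (sym e) (lookup-drop-self x ρ))))
  ... | no u≢x | yes refl = ⊥-elim (good-avoids g u∈ x∈T u≢x
    (trans (sym (lookup-drop-other ρ u≢x)) (trans e (lookup-drop-self x ρ))))
  ... | no u≢x | no v≢x = injective-on g u∈ v∈
    (trans (sym (lookup-drop-other ρ u≢x)) (trans e (lookup-drop-other ρ v≢x)))
  fixed : ∀ {u} → u ∈ T → ρ' u ≡ u ⊎ ρ' u ∉ T
  fixed {u} u∈ with u ≟ x
  ... | yes refl = inj₁ (lookup-drop-self x ρ)
  ... | no u≢x rewrite lookup-drop-other ρ u≢x = fixed-or-fresh g u∈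

remove-rename : ∀ {ρ T x L} → Good ρ T → x ∈ T → L ⊆ T →
                remove x (map (lookupRen (dropRen x ρ)) L) ≡ map (lookupRen ρ) (remove x L)
remove-rename {ρ} {x = x} {L} g x∈T L⊆T =
  remove-map (lookupRen ρ) (lookupRen (dropRen x ρ)) L
    (λ { _ refl → lookup-drop-self x ρ })
    (λ z∈ z≢x → lookup-drop-other ρ z≢x , good-avoids g (L⊆T z∈) x∈T z≢x)

module _ {ρ : Ren} where
  good-lam : ∀ x M → Good ρ (allVars (lam x M)) → Good (dropRen x ρ) (allVars M)
  good-lam x M g = good-⊆ there (good-drop (here refl) g)

  good-appˡ : ∀ M N → Good ρ (allVars (app M N)) → Good ρ (allVars M)
  good-appˡ M N = good-⊆ (xs⊆xs++ys (allVars M) (allVars N))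

  good-appʳ : ∀ M N → Good ρ (allVars (app M N)) → Good ρ (allVars N)
  good-appʳ M N = good-⊆ (xs⊆ys++xs (allVars N) (allVars M))

  good-era : ∀ x M → Good ρ (allVars (era x M)) → Good ρ (allVars M)
  good-era x M = good-⊆ there

  good-dup : ∀ x x₁ x₂ M → Good ρ (allVars (dup x x₁ x₂ M)) →
             Good (dropRen x₂ (dropRen x₁ ρ)) (allVars M)
  good-dup x x₁ x₂ M g =
    good-⊆ (there ∘ there ∘ there)
           (good-drop (there (there (here refl))) (good-drop (there (here refl)) g))

  good-subˡ : ∀ M N x → Good ρ (allVars (sub M N x)) → Good (dropRen x ρ) (allVars M)
  good-subˡ M N x g = good-⊆ (there ∘ ∈-++⁺ˡ) (good-drop (here refl) g)

  good-subʳ : ∀ M N x → Good ρ (allVars (sub M N x)) → Good ρ (allVars N)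
  good-subʳ M N x = good-⊆ (there ∘ ∈-++⁺ʳ (allVars M))

rename-fv : ∀ N ρ → Good ρ (allVars N) → fv (rename ρ N) ≡ map (lookupRen ρ) (fv N)
rename-fv (var x) ρ g = refl
rename-fv (lam x M) ρ g =
  trans (cong (remove x) (rename-fv M (dropRen x ρ) (good-lam x M g)))
        (remove-rename g (here refl) (there ∘ fv⊆allVars M))
rename-fv (app M N) ρ g =
  trans (cong₂ _++_ (rename-fv M ρ (good-appˡ M N g)) (rename-fv N ρ (good-appʳ M N g)))
        (sym (map-++ (lookupRen ρ) (fv M) (fv N)))
rename-fv (era x M) ρ g = cong (lookupRen ρ x ∷_) (rename-fv M ρ (good-era x M g))
rename-fv (dup x x₁ x₂ M) ρ g = cong (lookupRen ρ x ∷_) (begin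
  remove x₂ (remove x₁ (fv (rename ρ₂ M)))
    ≡⟨ cong (remove x₂ ∘ remove x₁) (rename-fv M ρ₂ (good-dup x x₁ x₂ M g)) ⟩
  remove x₂ (remove x₁ (map (lookupRen ρ₂) (fv M)))
    ≡⟨ remove-comm x₂ x₁ (map (lookupRen ρ₂) (fv M)) ⟩
  remove x₁ (remove x₂ (map (lookupRen ρ₂) (fv M)))
    ≡⟨ cong (remove x₁) (remove-rename (good-drop x₁∈ g) x₂∈ fvM⊆) ⟩
  remove x₁ (map (lookupRen ρ₁) (remove x₂ (fv M)))
    ≡⟨ remove-rename g x₁∈ (fvM⊆ ∘ proj₁ ∘ ∈-remove⁻ (fv M)) ⟩
  map (lookupRen ρ) (remove x₁ (remove x₂ (fv M)))
    ≡⟨ cong (map (lookupRen ρ)) (remove-comm x₁ x₂ (fv M)) ⟩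
  map (lookupRen ρ) (remove x₂ (remove x₁ (fv M)))  ∎)
  where
  open ≡-Reasoning
  ρ₁ = dropRen x₁ ρ
  ρ₂ = dropRen x₂ ρ₁
  x₁∈ : x₁ ∈ allVars (dup x x₁ x₂ M)
  x₁∈ = there (here refl)
  x₂∈ : x₂ ∈ allVars (dup x x₁ x₂ M)
  x₂∈ = there (there (here refl))
  fvM⊆ : fv M ⊆ allVars (dup x x₁ x₂ M)
  fvM⊆ = there ∘ there ∘ there ∘ fv⊆allVars M
rename-fv (sub M N x) ρ g =
  trans (cong₂ _++_ body (rename-fv N ρ (good-subʳ M N x g)))
        (sym (map-++ (lookupRen ρ) (remove x (fv M)) (fv N)))
  where
  body : remove x (fv (rename (dropRen x ρ) M)) ≡ map (lookupRen ρ) (remove x (fv M))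
  body = trans (cong (remove x) (rename-fv M (dropRen x ρ) (good-subˡ M N x g)))
               (remove-rename g (here refl) (there ∘ ∈-++⁺ˡ ∘ fv⊆allVars M))

∈-rename : ∀ M {ρ z} → Good ρ (allVars M) → z ∈ fv M → lookupRen ρ z ∈ fv (rename ρ M)
∈-rename M {ρ} g z∈ = subst (_ ∈_) (sym (rename-fv M ρ g)) (∈-map⁺ (lookupRen ρ) z∈)

-- A good renaming of a term of Λ_® is again in Λ_®: binders are unchanged, and
-- the side conditions are transported along rename-fv, ρ being injective.
rename-WF₀ : ∀ N ρ → Good ρ (allVars N) → WF₀ N → WF₀ (rename ρ N)
rename-WF₀ (var x) ρ g (var .x) = var _
rename-WF₀ (lam x M) ρ g (lam w x∈) =
  lam (rename-WF₀ M (dropRen x ρ) gM w)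
      (subst (_∈ fv (rename (dropRen x ρ) M)) (lookup-drop-self x ρ) (∈-rename M gM x∈))
  where
  gM : Good (dropRen x ρ) (allVars M)
  gM = good-lam x M g
rename-WF₀ (app M N) ρ g (app w v d) =
  app (rename-WF₀ M ρ gM w) (rename-WF₀ N ρ gN v)
      (subst₂ Disjoint (sym (rename-fv M ρ gM)) (sym (rename-fv N ρ gN))
              (disjoint-map (injective-on g) (fv⊆allVars (app M N) ∘ ∈-++⁺ˡ)
                            (fv⊆allVars (app M N) ∘ ∈-++⁺ʳ (fv M)) d))
  where
  gM = good-appˡ M N g
  gN = good-appʳ M N g
rename-WF₀ (era x M) ρ g (era w x∉) =
  era (rename-WF₀ M ρ (good-era x M g) w)
      (subst (lookupRen ρ x ∉_) (sym (rename-fv M ρ (good-era x M g)))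
             (∉-map (injective-on g) (here refl) (fv⊆allVars (era x M) ∘ there) x∉))
rename-WF₀ (dup x x₁ x₂ M) ρ g (dup w x₁∈ x₂∈ x₁≢x₂ x∉) =
  dup (rename-WF₀ M ρ₂ gM w)
      (subst (_∈ fv (rename ρ₂ M)) x₁-kept (∈-rename M gM x₁∈))
      (subst (_∈ fv (rename ρ₂ M)) (lookup-drop-self x₂ (dropRen x₁ ρ)) (∈-rename M gM x₂∈))
      x₁≢x₂
      (subst (lookupRen ρ x ∉_) (sym (∷-injectiveʳ (rename-fv (dup x x₁ x₂ M) ρ g)))
             (∉-map (injective-on g) (here refl) (fv⊆allVars (dup x x₁ x₂ M) ∘ there) x∉))
  where
  ρ₂ = dropRen x₂ (dropRen x₁ ρ)
  gM : Good ρ₂ (allVars M)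
  gM = good-dup x x₁ x₂ M g
  x₁-kept : lookupRen ρ₂ x₁ ≡ x₁
  x₁-kept = trans (lookup-drop-other (dropRen x₁ ρ) x₁≢x₂) (lookup-drop-self x₁ ρ)

lookup-zip : ∀ K Y u → lookupRen (zip K Y) u ≡ u ⊎ lookupRen (zip K Y) u ∈ Y
lookup-zip [] Y u = inj₁ refl
lookup-zip (k ∷ K) [] u = inj₁ refl
lookup-zip (k ∷ K) (y ∷ Y) u with u ≟ k
... | yes refl = inj₂ (here (lookup-hit u y (zip K Y)))
... | no u≢k =
  subst (λ v → v ≡ u ⊎ v ∈ y ∷ Y) (sym (lookup-miss (zip K Y) u≢k))
        (Sum.map₂ there (lookup-zip K Y u))

zip-avoids-head : ∀ K {y Y w} → Unique (y ∷ Y) → w ∉ y ∷ Y → lookupRen (zip K Y) w ≢ y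
zip-avoids-head K {y} {Y} {w} uyY w∉ ρw≡y with lookup-zip K Y w
... | inj₁ ρw≡w = w∉ (here (trans (sym ρw≡w) ρw≡y))
... | inj₂ ρw∈Y = unique-head uyY (subst (_∈ Y) ρw≡y ρw∈Y)

zip-injective : ∀ K Y → Unique Y → ∀ {u v} → u ∉ Y → v ∉ Y →
                lookupRen (zip K Y) u ≡ lookupRen (zip K Y) v → u ≡ v
zip-injective [] Y uY u∉ v∉ e = e
zip-injective (k ∷ K) [] uY u∉ v∉ e = e
zip-injective (k ∷ K) (y ∷ Y) uyY@(_ ∷ uY) {u} {v} u∉ v∉ e with u ≟ k | v ≟ k
... | yes refl | yes refl = refl
... | yes refl | no v≢k = ⊥-elim (zip-avoids-head K uyY v∉
  (trans (sym (lookup-miss (zip K Y) v≢k)) (trans (sym e) (lookup-hit u y (zip K Y)))))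
... | no u≢k | yes refl = ⊥-elim (zip-avoids-head K uyY u∉
  (trans (sym (lookup-miss (zip K Y) u≢k)) (trans e (lookup-hit v y (zip K Y)))))
... | no u≢k | no v≢k = zip-injective K Y uY (u∉ ∘ there) (v∉ ∘ there)
  (trans (sym (lookup-miss (zip K Y) u≢k)) (trans e (lookup-miss (zip K Y) v≢k)))

zip-good : ∀ K Y {T} → Unique Y → Disjoint T Y → Good (zip K Y) T
zip-good K Y uY fresh = record
  { injective-on   = λ u∈ v∈ → zip-injective K Y uY (fresh u∈) (fresh v∈)
  ; fixed-or-fresh = λ {u} u∈ →
      Sum.map₂ (λ ρu∈Y ρu∈T → fresh ρu∈T ρu∈Y) (lookup-zip K Y u) }

map-zip : ∀ K Y → Unique K → length Y ≡ length K → map (lookupRen (zip K Y)) K ≡ Y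
map-zip [] [] uK lY = refl
map-zip (k ∷ K) (y ∷ Y) ukK@(_ ∷ uK) lY = cong₂ _∷_ (lookup-hit k y (zip K Y)) (begin
  map (lookupRen ((k , y) ∷ zip K Y)) K  ≡⟨ map-cong-local (All.tabulate tail-unchanged) ⟩
  map (lookupRen (zip K Y)) K            ≡⟨ map-zip K Y uK (suc-injective lY) ⟩
  Y                                      ∎)
  where
  open ≡-Reasoning
  tail-unchanged : ∀ {z} → z ∈ K → lookupRen ((k , y) ∷ zip K Y) z ≡ lookupRen (zip K Y) z
  tail-unchanged z∈K = lookup-miss (zip K Y) (λ z≡k → unique-head ukK (subst (_∈ K) z≡k z∈K))

-- A copy of a term N of Λ_® whose free variables Fv[N] are renamed to a
-- fresh list Y; this is how N₁, N₂ arise in the duplication rule.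
fresh-copy : ∀ {N} Y → WF₀ N → Unique Y → length Y ≡ length (fv N) →
             Disjoint (allVars N) Y →
             WF₀ (rename (zip (fv N) Y) N) × fv (rename (zip (fv N) Y) N) ≡ Y
fresh-copy {N} Y w₀ uY lY fresh =
  rename-WF₀ N _ good w₀ , trans (rename-fv N _ good) (map-zip (fv N) Y (fv-unique w₀) lY)
  where
  good : Good (zip (fv N) Y) (allVars N)
  good = zip-good (fv N) Y uY fresh

fv-erasures : ∀ K M → fv (erasures K M) ≡ K ++ fv M
fv-erasures [] M = refl
fv-erasures (k ∷ K) M = cong (k ∷_) (fv-erasures K M)

erasures-WF : ∀ {K M} → Unique K → Disjoint K (fv M) → WF M → WF (erasures K M)
erasures-WF {[]} _ _ w = w
erasures-WF {k ∷ K} {M} ukK@(_ ∷ uK) d w =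
  era (erasures-WF uK (λ z∈K → d (there z∈K)) w)
      (subst (k ∉_) (sym (fv-erasures K M)) (∉-++ (unique-head ukK) (d (here refl))))

data Aligned : List Var → List Var → List Var → Set where
  aligned-[] : Aligned [] [] []
  aligned-∷  : ∀ {k y z K Y Z} → Aligned K Y Z → Aligned (k ∷ K) (y ∷ Y) (z ∷ Z)

aligned : ∀ {K Y Z} → length Y ≡ length K → length Z ≡ length K → Aligned K Y Z
aligned {[]}    {[]}    {[]}    _  _  = aligned-[]
aligned {k ∷ K} {y ∷ Y} {z ∷ Z} lY lZ =
  aligned-∷ (aligned (suc-injective lY) (suc-injective lZ))

++-⊆-∷ : ∀ {y z : Var} Y Z → Y ++ Z ⊆ (y ∷ Y) ++ (z ∷ Z)
++-⊆-∷ {y} {z} Y Z = there ∘ ++⁺ ⊆-refl (xs⊆x∷xs Z z)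

∈-dups⁻ : ∀ {K Y Z D w} → Aligned K Y Z →
          w ∈ fv (dups K Y Z D) → w ∈ K ⊎ (w ∈ fv D × w ∉ Y ++ Z)
∈-dups⁻ aligned-[] w∈ = inj₂ (w∈ , λ ())
∈-dups⁻ (aligned-∷ a) (here refl) = inj₁ (here refl)
∈-dups⁻ {k ∷ K} {y ∷ Y} {z ∷ Z} {D} {w} (aligned-∷ a) (there w∈) with ∈-remove⁻ _ w∈
... | w∈' , w≢z with ∈-remove⁻ _ w∈'
... | w∈D' , w≢y with ∈-dups⁻ a w∈D'
... | inj₁ w∈K = inj₁ (there w∈K)
... | inj₂ (w∈D , w∉YZ) = inj₂ (w∈D , w∉)
  where
  w∉ : w ∉ (y ∷ Y) ++ (z ∷ Z)
  w∉ (here w≡y) = w≢y w≡y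
  w∉ (there w∈) with ∈-++⁻ Y w∈
  ... | inj₁ w∈Y         = w∉YZ (∈-++⁺ˡ w∈Y)
  ... | inj₂ (here w≡z)  = w≢z w≡z
  ... | inj₂ (there w∈Z) = w∉YZ (∈-++⁺ʳ Y w∈Z)

∈-dups⁺ : ∀ {K Y Z D w} → Aligned K Y Z → Disjoint K (Y ++ Z) →
          w ∈ K ⊎ (w ∈ fv D × w ∉ Y ++ Z) → w ∈ fv (dups K Y Z D)
∈-dups⁺ aligned-[] _ (inj₂ (w∈D , _)) = w∈D
∈-dups⁺ (aligned-∷ a) _ (inj₁ (here refl)) = here refl
∈-dups⁺ {k ∷ K} {y ∷ Y} {z ∷ Z} (aligned-∷ a) d (inj₁ (there w∈K)) =
  there (∈-remove⁺ (∈-remove⁺ (∈-dups⁺ a (disjoint-⊆ there (++-⊆-∷ Y Z) d) (inj₁ w∈K))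
                              (λ w≡y → d (there w∈K) (here w≡y)))
                   (λ w≡z → d (there w∈K) (∈-++⁺ʳ (y ∷ Y) (here w≡z))))
∈-dups⁺ {k ∷ K} {y ∷ Y} {z ∷ Z} (aligned-∷ a) d (inj₂ (w∈D , w∉)) =
  there (∈-remove⁺ (∈-remove⁺ (∈-dups⁺ a (disjoint-⊆ there (++-⊆-∷ Y Z) d)
                                         (inj₂ (w∈D , w∉ ∘ ++-⊆-∷ Y Z)))
                              (λ w≡y → w∉ (here w≡y)))
                   (λ w≡z → w∉ (∈-++⁺ʳ (y ∷ Y) (here w≡z))))

fv-dups : ∀ {K Y Z D R} → Aligned K Y Z → Disjoint K (Y ++ Z) → Disjoint R (Y ++ Z) →
          fv D ≋ R ++ (Y ++ Z) → fv (dups K Y Z D) ≋ K ++ R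
fv-dups {K} {Y} {Z} {D} {R} a dK dR (D⊆ , ⊆D) = to , from
  where
  to : fv (dups K Y Z D) ⊆ K ++ R
  to w∈ with ∈-dups⁻ a w∈
  ... | inj₁ w∈K = ∈-++⁺ˡ w∈K
  ... | inj₂ (w∈D , w∉YZ) with ∈-++⁻ R (D⊆ w∈D)
  ...   | inj₁ w∈R  = ∈-++⁺ʳ K w∈R
  ...   | inj₂ w∈YZ = ⊥-elim (w∉YZ w∈YZ)
  from : K ++ R ⊆ fv (dups K Y Z D)
  from w∈ with ∈-++⁻ K w∈
  ... | inj₁ w∈K = ∈-dups⁺ {D = D} a dK (inj₁ w∈K)
  ... | inj₂ w∈R = ∈-dups⁺ a dK (inj₂ (⊆D (∈-++⁺ˡ w∈R) , dR w∈R))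

dups-WF : ∀ {K Y Z D} → Aligned K Y Z → Unique K → Unique Y → Unique Z → Disjoint Y Z →
          Disjoint K (Y ++ Z) → Disjoint K (fv D) → Y ++ Z ⊆ fv D → WF D →
          WF (dups K Y Z D)
dups-WF aligned-[] _ _ _ _ _ _ _ w = w
dups-WF {k ∷ K} {y ∷ Y} {z ∷ Z} {D} (aligned-∷ a) ukK@(_ ∷ uK) uyY@(_ ∷ uY) uzZ@(_ ∷ uZ)
        dYZ dKYZ dKD YZ⊆D w =
  dup (dups-WF a uK uY uZ dYZ' dKYZ' (λ u∈K → dKD (there u∈K)) (YZ⊆D ∘ ++-⊆-∷ Y Z) w)
      y∈ z∈ (λ y≡z → dYZ (here refl) (here y≡z)) k∉
  where
  dYZ' : Disjoint Y Z
  dYZ' u∈Y u∈Z = dYZ (there u∈Y) (there u∈Z)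
  dKYZ' : Disjoint K (Y ++ Z)
  dKYZ' = disjoint-⊆ there (++-⊆-∷ Y Z) dKYZ
  y∈ : y ∈ fv (dups K Y Z D)
  y∈ = ∈-dups⁺ a dKYZ' (inj₂ (YZ⊆D (here refl) ,
                              ∉-++ (unique-head uyY) (λ y∈Z → dYZ (here refl) (there y∈Z))))
  z∈ : z ∈ fv (dups K Y Z D)
  z∈ = ∈-dups⁺ a dKYZ' (inj₂ (YZ⊆D (∈-++⁺ʳ (y ∷ Y) (here refl)) ,
                              ∉-++ (λ z∈Y → dYZ (there z∈Y) (here refl)) (unique-head uzZ)))
  k∉ : k ∉ remove z (remove y (fv (dups K Y Z D)))
  k∉ k∈ with ∈-dups⁻ a (proj₁ (∈-remove⁻ _ (proj₁ (∈-remove⁻ _ k∈))))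
  ... | inj₁ k∈K = unique-head ukK k∈K
  ... | inj₂ (k∈D , _) = dKD (here refl) k∈D

var-rule : ∀ {x N} → sub (var x) N x ⊑ N
var-rule {x} {N} (sub _ _ w₀ _) = WF₀⇒WF w₀ , ≡⇒≋ (cong (_++ fv N) (remove-self x []))

lam-rule : ∀ {x y M N} → x ≢ y → y ∉ fv N → sub (lam y M) N x ⊑ lam y (sub M N x)
lam-rule {x} {y} {M} {N} x≢y y∉N (sub (lam w y∈M) x∈ w₀ d) =
  lam (sub w (proj₁ (∈-remove⁻ (fv M) x∈)) w₀ d') (∈-++⁺ˡ (∈-remove⁺ y∈M (≢-sym x≢y))) ,
  ≡⇒≋ (sym fv-body)
  where
  fv-body : remove y (remove x (fv M) ++ fv N) ≡ remove x (remove y (fv M)) ++ fv N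
  fv-body = trans (remove-++-fresh (remove x (fv M)) y∉N)
                  (cong (_++ fv N) (remove-comm y x (fv M)))
  d' : Disjoint (remove x (fv M)) (fv N)
  d' = disjoint-remove y∉N (subst (λ L → Disjoint L (fv N)) (remove-comm x y (fv M)) d)

appˡ-rule : ∀ {x M P N} → x ∈ fv M → sub (app M P) N x ⊑ app (sub M N x) P
appˡ-rule {x} {M} {P} {N} x∈M (sub (app wM wP dMP) _ w₀ d) =
  app (sub wM x∈M w₀ (disjoint-⊆ˡ (xs⊆xs++ys _ _) d')) wP
      (disjoint-++ (disjoint-⊆ˡ (proj₁ ∘ ∈-remove⁻ (fv M)) dMP)
                   (disjoint-sym (disjoint-⊆ˡ (xs⊆ys++xs (fv P) (remove x (fv M))) d'))) ,
  ≋-trans (≡⇒≋ (cong (_++ fv N) split)) (++-exchange-≋ (remove x (fv M)) (fv P) (fv N))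
  where
  split : remove x (fv M ++ fv P) ≡ remove x (fv M) ++ fv P
  split = remove-++-fresh (fv M) (dMP x∈M)
  d' : Disjoint (remove x (fv M) ++ fv P) (fv N)
  d' = subst (λ L → Disjoint L (fv N)) split d

appʳ-rule : ∀ {x M P N} → x ∈ fv P → sub (app M P) N x ⊑ app M (sub P N x)
appʳ-rule {x} {M} {P} {N} x∈P (sub (app wM wP dMP) _ w₀ d) =
  app wM (sub wP x∈P w₀ (disjoint-⊆ˡ (xs⊆ys++xs (remove x (fv P)) (fv M)) d'))
      (disjoint-sym (disjoint-++ (disjoint-⊆ˡ (proj₁ ∘ ∈-remove⁻ (fv P)) (disjoint-sym dMP))
                                 (disjoint-sym (disjoint-⊆ˡ (xs⊆xs++ys _ _) d')))) ,
  ≡⇒≋ (trans (cong (_++ fv N) split) (++-assoc (fv M) (remove x (fv P)) (fv N)))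
  where
  split : remove x (fv M ++ fv P) ≡ fv M ++ remove x (fv P)
  split = trans (remove-++ x (fv M) (fv P))
                (cong (_++ remove x (fv P)) (remove-fresh (fv M) (λ x∈M → dMP x∈M x∈P)))
  d' : Disjoint (fv M ++ remove x (fv P)) (fv N)
  d' = subst (λ L → Disjoint L (fv N)) split d

era-rule : ∀ {x y M N} → x ≢ y → sub (era y M) N x ⊑ era y (sub M N x)
era-rule {x} {y} {M} {N} x≢y (sub (era wM y∉M) x∈ w₀ d) =
  era (sub wM (∈-tail x∈ x≢y) w₀ (disjoint-⊆ˡ there d'))
      (∉-++ (y∉M ∘ proj₁ ∘ ∈-remove⁻ (fv M)) (d' (here refl))) ,
  ≡⇒≋ (cong (_++ fv N) split)
  where
  split : remove x (y ∷ fv M) ≡ y ∷ remove x (fv M)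
  split = remove-other (fv M) (≢-sym x≢y)
  d' : Disjoint (y ∷ remove x (fv M)) (fv N)
  d' = subst (λ L → Disjoint L (fv N)) split d

eraₓ-rule : ∀ {x M N} → sub (era x M) N x ⊑ erasures (fv N) M
eraₓ-rule {x} {M} {N} (sub (era wM x∉M) _ w₀ d) =
  erasures-WF (fv-unique w₀) (disjoint-sym d') wM ,
  ≋-trans (≡⇒≋ (cong (_++ fv N) body))
          (≋-trans (++-comm-≋ (fv M) (fv N)) (≡⇒≋ (sym (fv-erasures (fv N) M))))
  where
  body : remove x (x ∷ fv M) ≡ fv M
  body = trans (remove-self x (fv M)) (remove-fresh (fv M) x∉M)
  d' : Disjoint (fv M) (fv N)
  d' = subst (λ L → Disjoint L (fv N)) body d

dup-rule : ∀ {x y y₁ y₂ M N} → x ≢ y → y₁ ∉ fv N → y₂ ∉ fv N →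
           sub (dup y y₁ y₂ M) N x ⊑ dup y y₁ y₂ (sub M N x)
dup-rule {x} {y} {y₁} {y₂} {M} {N} x≢y y₁∉N y₂∉N
         (sub (dup wM y₁∈ y₂∈ y₁≢y₂ y∉) x∈ w₀ d) =
  dup (sub wM (proj₁ x∈M) w₀ dMN)
      (∈-++⁺ˡ (∈-remove⁺ y₁∈ (≢-sym (proj₂ x∈M)))) (∈-++⁺ˡ (∈-remove⁺ y₂∈ (≢-sym (proj₂ x∈R₁))))
      y₁≢y₂ (subst (y ∉_) (sym body) (∉-++ (y∉ ∘ proj₁ ∘ ∈-remove⁻ R) (d' (here refl)))) ,
  ≡⇒≋ (trans (cong (_++ fv N) split) (cong (y ∷_) (sym body)))
  where
  R = remove y₂ (remove y₁ (fv M))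
  x∈R₁ : x ∈ remove y₁ (fv M) × x ≢ y₂
  x∈R₁ = ∈-remove⁻ (remove y₁ (fv M)) (∈-tail x∈ x≢y)
  x∈M : x ∈ fv M × x ≢ y₁
  x∈M = ∈-remove⁻ (fv M) (proj₁ x∈R₁)
  split : remove x (y ∷ R) ≡ y ∷ remove x R
  split = remove-other R (≢-sym x≢y)
  d' : Disjoint (y ∷ remove x R) (fv N)
  d' = subst (λ L → Disjoint L (fv N)) split d
  comm : remove y₂ (remove y₁ (remove x (fv M))) ≡ remove x R
  comm = trans (cong (remove y₂) (remove-comm y₁ x (fv M)))
               (remove-comm y₂ x (remove y₁ (fv M)))
  body : remove y₂ (remove y₁ (remove x (fv M) ++ fv N)) ≡ remove x R ++ fv N
  body = begin
    remove y₂ (remove y₁ (remove x (fv M) ++ fv N))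
      ≡⟨ cong (remove y₂) (remove-++-fresh (remove x (fv M)) y₁∉N) ⟩
    remove y₂ (remove y₁ (remove x (fv M)) ++ fv N)
      ≡⟨ remove-++-fresh (remove y₁ (remove x (fv M))) y₂∉N ⟩
    remove y₂ (remove y₁ (remove x (fv M))) ++ fv N
      ≡⟨ cong (_++ fv N) comm ⟩
    remove x R ++ fv N
      ∎
    where open ≡-Reasoning
  dMN : Disjoint (remove x (fv M)) (fv N)
  dMN = disjoint-remove y₁∉N (disjoint-remove y₂∉N
          (subst (λ L → Disjoint L (fv N)) (sym comm) (disjoint-⊆ˡ there d')))

dupₓ-contractum :
  ∀ {M N₁ N₂ x₁ x₂} K Y Z → fv N₁ ≡ Y → fv N₂ ≡ Z → Aligned K Y Z →
  WF M → x₁ ∈ fv M → x₂ ∈ fv M → x₁ ≢ x₂ → WF₀ N₁ → WF₀ N₂ → Unique K → Disjoint Y Z →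
  Disjoint (fv M) (Y ++ Z) → x₂ ∉ Y →
  Disjoint K (Y ++ Z) → Disjoint K (remove x₂ (remove x₁ (fv M))) →
  WF (dups K (fv N₁) (fv N₂) (sub (sub M N₁ x₁) N₂ x₂)) ×
  fv (dups K (fv N₁) (fv N₂) (sub (sub M N₁ x₁) N₂ x₂)) ≋ K ++ remove x₂ (remove x₁ (fv M))
dupₓ-contractum {M} {N₁} {N₂} {x₁} {x₂} K _ _ refl refl a
                wM x₁∈ x₂∈ x₁≢x₂ w₁ w₂ uK dYZ dMYZ x₂∉Y dKYZ dKR =
  dups-WF a uK (fv-unique w₁) (fv-unique w₂) dYZ dKYZ dKB YZ⊆B wB ,
  fv-dups a dKYZ (disjoint-⊆ˡ R⊆M dMYZ) (≡⇒≋ fv-body)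
  where
  Y = fv N₁
  Z = fv N₂
  R = remove x₂ (remove x₁ (fv M))
  R⊆M : R ⊆ fv M
  R⊆M = proj₁ ∘ ∈-remove⁻ (fv M) ∘ proj₁ ∘ ∈-remove⁻ (remove x₁ (fv M))
  inner : remove x₂ (remove x₁ (fv M) ++ Y) ≡ R ++ Y
  inner = remove-++-fresh (remove x₁ (fv M)) x₂∉Y
  fv-body : fv (sub (sub M N₁ x₁) N₂ x₂) ≡ R ++ (Y ++ Z)
  fv-body = trans (cong (_++ Z) inner) (++-assoc R Y Z)
  wB : WF (sub (sub M N₁ x₁) N₂ x₂)
  wB = sub (sub wM x₁∈ w₁ (disjoint-⊆ (proj₁ ∘ ∈-remove⁻ (fv M)) (xs⊆xs++ys Y Z) dMYZ))
           (∈-++⁺ˡ (∈-remove⁺ x₂∈ (≢-sym x₁≢x₂))) w₂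
           (subst (λ L → Disjoint L Z) (sym inner)
                  (disjoint-++ (disjoint-⊆ R⊆M (xs⊆ys++xs Z Y) dMYZ) dYZ))
  dKB : Disjoint K (fv (sub (sub M N₁ x₁) N₂ x₂))
  dKB = subst (Disjoint K) (sym fv-body)
              (disjoint-sym (disjoint-++ (disjoint-sym dKR) (disjoint-sym dKYZ)))
  YZ⊆B : Y ++ Z ⊆ fv (sub (sub M N₁ x₁) N₂ x₂)
  YZ⊆B = subst (Y ++ Z ⊆_) (sym fv-body) (xs⊆ys++xs (Y ++ Z) R)

dupₓ-rule :
  ∀ {x x₁ x₂ M N} Y Z → length Y ≡ length (fv N) → length Z ≡ length (fv N) →
  Unique (Y ++ Z) →
  Disjoint (Y ++ Z) (allVars (sub (dup x x₁ x₂ M) N x)) →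
  sub (dup x x₁ x₂ M) N x ⊑
    dups (fv N) (fv (rename (zip (fv N) Y) N)) (fv (rename (zip (fv N) Z) N))
         (sub (sub M (rename (zip (fv N) Y) N) x₁) (rename (zip (fv N) Z) N) x₂)
dupₓ-rule {x} {x₁} {x₂} {M} {N} Y Z lY lZ uYZ fresh
          (sub (dup wM x₁∈ x₂∈ x₁≢x₂ x∉R) _ w₀ d) =
  let uY , uZ , dYZ = unique-++⁻ Y uYZ
      w₁ , fvN₁ = fresh-copy Y w₀ uY lY (λ u∈N u∈Y → fresh (∈-++⁺ˡ u∈Y) (N⊆ u∈N))
      w₂ , fvN₂ = fresh-copy Z w₀ uZ lZ (λ u∈N u∈Z → fresh (∈-++⁺ʳ Y u∈Z) (N⊆ u∈N))
      wC , fvC = dupₓ-contractum (fv N) Y Z fvN₁ fvN₂ (aligned lY lZ) wM x₁∈ x₂∈ x₁≢x₂ w₁ w₂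
                   (fv-unique w₀) dYZ dMYZ x₂∉Y dNYZ (disjoint-sym dRN)
  in  wC , ≋-trans (≡⇒≋ (cong (_++ fv N) body)) (≋-trans (++-comm-≋ R (fv N)) (≋-sym fvC))
  where
  R = remove x₂ (remove x₁ (fv M))
  dup⊆ : allVars (dup x x₁ x₂ M) ⊆ allVars (sub (dup x x₁ x₂ M) N x)
  dup⊆ = there ∘ ∈-++⁺ˡ
  M⊆ : allVars M ⊆ allVars (sub (dup x x₁ x₂ M) N x)
  M⊆ = dup⊆ ∘ there ∘ there ∘ there
  N⊆ : allVars N ⊆ allVars (sub (dup x x₁ x₂ M) N x)
  N⊆ = there ∘ ∈-++⁺ʳ (allVars (dup x x₁ x₂ M))
  dMYZ : Disjoint (fv M) (Y ++ Z)
  dMYZ u∈M u∈YZ = fresh u∈YZ (M⊆ (fv⊆allVars M u∈M))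
  dNYZ : Disjoint (fv N) (Y ++ Z)
  dNYZ u∈N u∈YZ = fresh u∈YZ (N⊆ (fv⊆allVars N u∈N))
  x₂∉Y : x₂ ∉ Y
  x₂∉Y x₂∈Y = fresh (∈-++⁺ˡ x₂∈Y) (dup⊆ (there (there (here refl))))
  body : remove x (x ∷ R) ≡ R
  body = trans (remove-self x R) (remove-fresh R x∉R)
  dRN : Disjoint R (fv N)
  dRN = subst (λ L → Disjoint L (fv N)) body d

rule-⊑ : ∀ {M N} → M ↦ N → M ⊑ N
rule-⊑ r-var                        = var-rule
rule-⊑ (r-lam x≢y y∉N)              = lam-rule x≢y y∉N
rule-⊑ (r-appˡ x∈M)                 = appˡ-rule x∈M
rule-⊑ (r-appʳ x∈P)                 = appʳ-rule x∈P
rule-⊑ (r-era x≢y)                  = era-rule x≢y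
rule-⊑ r-eraₓ                       = eraₓ-rule
rule-⊑ (r-dup x≢y y₁∉N y₂∉N)        = dup-rule x≢y y₁∉N y₂∉N
rule-⊑ (r-dupₓ Y Z lY lZ uYZ fresh) = dupₓ-rule Y Z lY lZ uYZ fresh

-- By the congruences, every contextual step satisfies ⊑; steps inside the
-- substituted term N of M[N/x] are impossible, since N ∈ Λ_®.
context-⊑ : ∀ {M N} → M ⟶c N → M ⊑ N
context-⊑ (c-base r) = rule-⊑ r
context-⊑ (c-lam c)  = ⊑-lam (context-⊑ c)
context-⊑ (c-appˡ c) = ⊑-appˡ (context-⊑ c)
context-⊑ (c-appʳ c) = ⊑-appʳ (context-⊑ c)
context-⊑ (c-era c)  = ⊑-era (context-⊑ c)
context-⊑ (c-dup c)  = ⊑-dup (context-⊑ c)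
context-⊑ (c-subˡ c) = ⊑-subˡ (context-⊑ c)
context-⊑ (c-subʳ c) (sub _ _ w₀ _) = ⊥-elim (SubFree-irreducible (WF₀⇒SubFree w₀) c)

step-⊑ : ∀ {M N} → M ⟶ N → M ⊑ N
step-⊑ (step M≈M' M'⟶N' N'≈N) =
  ⊑-trans (proj₁ (α-⊑ M≈M')) (⊑-trans (context-⊑ M'⟶N') (proj₁ (α-⊑ N'≈N)))

steps-⊑ : ∀ {M N} → M ↠ N → M ⊑ N
steps-⊑ ε        = ⊑-refl
steps-⊑ (s ◅ ss) = ⊑-trans (step-⊑ s) (steps-⊑ ss)

mainTheorem4 : ∀ {Q R : Term} → WF Q → Q ↠ R →
    WF R × (∀ (z : Var) → (z ∈ fv Q) ⇔ (z ∈ fv R))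
mainTheorem4 wQ Q↠R =
  let wR , Q⊆R , R⊆Q = steps-⊑ Q↠R wQ
  in  wR , λ z → mk⇔ Q⊆R R⊆Q
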